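{- Let $(G,\sigma)$ and $(H,\sigma')$ be finite simple graphs with linear orderings of their vertex sets, and let $FF(G,\sigma)=p$ and $FF(H,\sigma')=q$. Then $FF(G\Box H,\mathrm{lex})=FF(K_p\Box K_q,\mathrm{lex})$.
   Context: $G\Box H$ is the Cartesian product: vertex set $V(G)\times V(H)$, with $(u,v)\sim(u',v')$ iff either $u=u'$ and $vv'\in E(H)$, or $uu'\in E(G)$ and $v=v'$. $K_n$ is the complete graph on $n$ vertices. The First-Fit coloring with respect to a vertex ordering scans vertices in order and gives each the smallest positive integer not used on its previously colored neighbors; $FF$ denotes the number of colors used. The lexicographic ordering $\mathrm{lex}$ of $V(G\Box H)$ induced by $\sigma,\sigma'$: $(u,v)$ precedes $(u',v')$ iff $\sigma(u)<\sigma(u')$, or $u=u'$ and $\sigma'(v)<\sigma'(v')$. For $K_p\Box K_q$, $\mathrm{lex}$ is induced by any orderings of the (interchangeable) vertices of $K_p$ and $K_q$. -}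

module Defs where

open import Data.Nat using (ℕ; zero; suc; _⊔_)
open import Data.Bool using (Bool; true; false; _∧_; _∨_; not)
open import Data.Fin using (Fin)
open import Data.Fin.Properties using (_≟_)
open import Data.List using (List; []; _∷_; map; concatMap; foldr)
open import Data.Bool.ListAction using (any)
open import Data.Product using (_×_; _,_; proj₁; proj₂)
open import Relation.Binary.PropositionalEquality using (_≡_)
open import Relation.Nullary.Decidable using (⌊_⌋)
open import Data.Nat using (_≡ᵇ_)
open import Function.Bundles using (_↔_; Inverse)

record Graph (n : ℕ) : Set where
  field
    adj   : Fin n → Fin n → Bool
    sym   : ∀ u v → adj u v ≡ adj v u
    irrefl : ∀ u → adj u u ≡ false
open Graph public

-- A linear ordering σ of Fin n: a bijection σ : Fin n ↔ Fin n, where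
-- σ(u) is the position of u.  We use the inverse to list the vertices
-- in increasing σ-order.
Ordering : ℕ → Set
Ordering n = Fin n ↔ Fin n

allFin : (n : ℕ) → List (Fin n)
allFin zero = []
allFin (suc n) = Fin.zero ∷ map Fin.suc (allFin n)

orderList : ∀ {n} → Ordering n → List (Fin n)
orderList {n} σ = map (Inverse.from σ) (allFin n)

-- Colours are positive integers.

usedOn : ∀ {V : Set} → (V → V → Bool) → List (V × ℕ) → V → ℕ → Bool
usedOn adj' done v c = any (λ p → adj' (proj₁ p) v ∧ (proj₂ p ≡ᵇ c)) done

firstFree : ∀ {V : Set} → (V → V → Bool) → List (V × ℕ) → V → ℕ → ℕ → ℕ
firstFree adj' done v c zero = c
firstFree adj' done v c (suc fuel) with usedOn adj' done v c
... | true  = firstFree adj' done v (suc c) fuel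
... | false = c

len : ∀ {A : Set} → List A → ℕ
len [] = 0
len (_ ∷ xs) = suc (len xs)

ffRun : ∀ {V : Set} → (V → V → Bool) → List (V × ℕ) → List V → List (V × ℕ)
ffRun adj' done [] = done
ffRun adj' done (v ∷ vs) =
  ffRun adj' ((v , firstFree adj' done v 1 (suc (len done))) ∷ done) vs

-- number of colours used = largest colour assigned (First-Fit uses
-- exactly the colours 1..max)
maxColour : ∀ {V : Set} → List (V × ℕ) → ℕ
maxColour = foldr (λ p m → proj₂ p ⊔ m) 0

FFgen : ∀ {V : Set} → (V → V → Bool) → List V → ℕ
FFgen adj' order = maxColour (ffRun adj' [] order)

FF : ∀ {n} → Graph n → Ordering n → ℕ
FF G σ = FFgen (adj G) (orderList σ)

eqᵇ : ∀ {n} → Fin n → Fin n → Bool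
eqᵇ u v = ⌊ u ≟ v ⌋

boxAdj : ∀ {m n} → Graph m → Graph n → Fin m × Fin n → Fin m × Fin n → Bool
boxAdj G H (u , v) (u' , v') =
  (eqᵇ u u' ∧ adj H v v') ∨ (adj G u u' ∧ eqᵇ v v')

lexList : ∀ {m n} → Ordering m → Ordering n → List (Fin m × Fin n)
lexList σ σ' = concatMap (λ u → map (λ v → (u , v)) (orderList σ')) (orderList σ)

FFbox : ∀ {m n} → Graph m → Ordering m → Graph n → Ordering n → ℕ
FFbox G σ H σ' = FFgen (boxAdj G H) (lexList σ σ')

K : (n : ℕ) → Graph n
K n = record
  { adj = λ u v → not (eqᵇ u v)
  ; sym = λ u v → symEq u v
  ; irrefl = λ u → irr u }
  where
  open import Relation.Binary.PropositionalEquality using (refl; cong)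
  open import Relation.Nullary using (yes; no)
  symEq : ∀ (u v : Fin n) → not (eqᵇ u v) ≡ not (eqᵇ v u)
  symEq u v with u ≟ v | v ≟ u
  ... | yes _ | yes _ = refl
  ... | no _  | no _  = refl
  ... | yes p | no q  = Data.Empty.⊥-elim (q (Relation.Binary.PropositionalEquality.sym p))
    where import Data.Empty
  ... | no p  | yes q = Data.Empty.⊥-elim (p (Relation.Binary.PropositionalEquality.sym q))
    where import Data.Empty
  irr : ∀ (u : Fin n) → not (eqᵇ u u) ≡ false
  irr u with u ≟ u
  ... | yes _ = refl
  ... | no q = Data.Empty.⊥-elim (q refl)
    where import Data.Empty

idOrd : (n : ℕ) → Ordering n
idOrd n = Function.Properties.Inverse.↔-refl {A = Fin n}
  where import Function.Properties.Inverse

-- First-Fit on G □ H in lexicographic order colours (u, v) with boxColour (a u) (b v), where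
-- a and b are the First-Fit colourings of the factors and boxColour x y is the least positive
-- integer different from every boxColour s y (s < x) and every boxColour x t (t < y).  Indeed the
-- earlier neighbours of (u, v) are the (u′, v) with u′ an earlier neighbour of u and the (u, v′)
-- with v′ an earlier neighbour of v; First-Fit on the factors makes exactly the colours 1 … a u − 1
-- appear on the former kind of u′ (and likewise for v), and never a u itself.  Since First-Fit
-- uses every colour from 1 to its maximum, FF(G □ H, lex) is the maximum of boxColour over
-- [1, FF(G)] × [1, FF(H)], which only depends on FF(G) and FF(H).
module Submission where

open import Data.Bool using (Bool; true; false; T; _∧_; _∨_)
open import Data.Bool.Properties using (T-∧; T-∨)
open import Data.Empty using (⊥-elim)
open import Data.Fin using (Fin; toℕ)
open import Data.Fin.Properties using (_≟_; pigeonhole; toℕ<n) renaming (suc-injective to Fin-suc-injective)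
open import Data.List using (List; []; _∷_; [_]; _++_; map; length; reverse; downFrom; lookup; concatMap; cartesianProduct)
open import Data.List.Properties
  using (length-map; ++-identityʳ; ++-assoc; map-++; map-∘; reverse-++; ∷-injective; cartesianProductWith-distribʳ-++)
open import Data.List.Membership.Propositional using (_∈_; _∉_; find; lose)
open import Data.List.Membership.Propositional.Properties
  using (∈-map⁺; ∈-map⁻; ∈-++⁺ˡ; ∈-++⁺ʳ; ∈-++⁻; ∈-∃++; ∈-downFrom⁺; ∈-downFrom⁻; ∈-cartesianProduct⁺; ∈-cartesianProduct⁻)
open import Data.List.Relation.Unary.Any using (here; there; index)
open import Data.List.Relation.Unary.Any.Properties using (any⁺; any⁻; lookup-index; reverse⁺; reverse⁻)
import Data.List.Relation.Unary.All as All
open import Data.List.Relation.Unary.All.Properties using (¬Any⇒All¬)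
open import Data.List.Relation.Unary.Unique.Propositional using (Unique; []; _∷_)
import Data.List.Relation.Unary.Unique.Propositional.Properties as Unique
open import Data.Nat using (ℕ; zero; suc; pred; _+_; _⊔_; _≤_; _<_; _≤?_; z≤n; s≤s)
open import Data.Nat.Properties hiding (_≟_)
open import Data.Product using (∃; ∃₂; _×_; _,_; proj₁; proj₂; map₁; map₂)
open import Data.Sum using (_⊎_; inj₁; inj₂)
import Data.Sum as Sum
open import Data.Unit using (tt)
open import Function using (id; _∘_; Equivalence; Inverse)
open import Relation.Binary.Definitions using (DecidableEquality; tri<; tri≈; tri>)
open import Relation.Binary.PropositionalEquality
  using (_≡_; _≢_; refl; sym; trans; cong; cong₂; subst; subst₂; module ≡-Reasoning)
open import Relation.Nullary using (¬_; yes; no)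
open import Relation.Nullary.Decidable using (toWitness; fromWitness)

open import Defs
  using ( Graph; adj; Ordering; allFin; orderList; usedOn; firstFree; len; ffRun; maxColour; FFgen
        ; FF; eqᵇ; boxAdj; FFbox; K; idOrd )

injection⇒≤length : ∀ {A : Set} (f : ℕ → A) → (∀ {i j} → f i ≡ f j → i ≡ j) →
                    ∀ {k} (xs : List A) → (∀ {z} → z < k → f z ∈ xs) → k ≤ length xs
injection⇒≤length f f-injective {k} xs f∈xs with k ≤? length xs
... | yes k≤ = k≤
... | no k≰ =
  let i , j , i<j , same = pigeonhole (≰⇒> k≰) position
  in ⊥-elim (<⇒≢ i<j (f-injective (begin
       f (toℕ i)              ≡⟨ lookup-index (f∈xs (toℕ<n i)) ⟩
       lookup xs (position i) ≡⟨ cong (lookup xs) same ⟩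
       lookup xs (position j) ≡⟨ lookup-index (f∈xs (toℕ<n j)) ⟨
       f (toℕ j)              ∎)))
  where
  open ≡-Reasoning
  position : Fin k → Fin (length xs)
  position i = index (f∈xs (toℕ<n i))

Unique-∉-prefix : ∀ {A : Set} {x : A} P {S} → Unique (P ++ x ∷ S) → x ∉ P
Unique-∉-prefix (y ∷ P) (y≢ ∷ _) (here refl) = All.lookup y≢ (∈-++⁺ʳ P (here refl)) refl
Unique-∉-prefix (y ∷ P) (_ ∷ u)  (there x∈P) = Unique-∉-prefix P u x∈P

∈-split : ∀ {A : Set} {xs P S : List A} {x w} → xs ≡ P ++ x ∷ S → w ∈ P ⊎ w ≡ x → w ∈ xs
∈-split         refl (inj₁ w∈P)  = ∈-++⁺ˡ w∈P
∈-split {P = P} refl (inj₂ refl) = ∈-++⁺ʳ P (here refl)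

len≡length : ∀ {A : Set} (xs : List A) → len xs ≡ length xs
len≡length []       = refl
len≡length (_ ∷ xs) = cong suc (len≡length xs)

record LeastFree (Used : ℕ → Set) (r : ℕ) : Set where
  field
    positive  : 1 ≤ r
    free      : ¬ Used r
    saturated : ∀ {z} → 1 ≤ z → z < r → Used z

module _ {Used : ℕ → Set} where
  open LeastFree

  LeastFree-unique : ∀ {r r′} → LeastFree Used r → LeastFree Used r′ → r ≡ r′
  LeastFree-unique {r} {r′} lf lf′ with <-cmp r r′
  ... | tri< r<r′ _ _ = ⊥-elim (free lf (saturated lf′ (positive lf) r<r′))
  ... | tri≈ _ r≡r′ _ = r≡r′
  ... | tri> _ _ r>r′ = ⊥-elim (free lf′ (saturated lf (positive lf′) r>r′))

  LeastFree-resp : ∀ {Used′ r} → (∀ {z} → Used z → Used′ z) → (∀ {z} → Used′ z → Used z) →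
                   LeastFree Used r → LeastFree Used′ r
  LeastFree-resp to from lf = record
    { positive = positive lf ; free = free lf ∘ from ; saturated = λ 1≤z z<r → to (saturated lf 1≤z z<r) }

maxColour-≥ : ∀ {V : Set} {D : List (V × ℕ)} {w z} → (w , z) ∈ D → z ≤ maxColour D
maxColour-≥ {D = (_ , c) ∷ D} (here refl)  = m≤m⊔n c (maxColour D)
maxColour-≥ {D = (_ , c) ∷ D} (there wz∈D) = ≤-trans (maxColour-≥ wz∈D) (m≤n⊔m c (maxColour D))

maxColour-attained : ∀ {V : Set} (D : List (V × ℕ)) → maxColour D ≡ 0 ⊎ ∃ λ w → (w , maxColour D) ∈ D
maxColour-attained []            = inj₁ refl
maxColour-attained ((w , c) ∷ D) with ⊔-sel c (maxColour D) | maxColour-attained D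
... | inj₁ ⊔≡c | _                = inj₂ (w , subst (λ k → (w , k) ∈ _) (sym ⊔≡c) (here refl))
... | inj₂ ⊔≡m | inj₁ m≡0         = inj₁ (trans ⊔≡m m≡0)
... | inj₂ ⊔≡m | inj₂ (w′ , w′m∈) = inj₂ (w′ , subst (λ k → (w′ , k) ∈ _) (sym ⊔≡m) (there w′m∈))

maxColour-downFrom : ∀ {V : Set} (D : List (V × ℕ)) {k} → map proj₂ D ≡ map suc (downFrom k) → maxColour D ≡ k
maxColour-downFrom []            {zero}  _     = refl
maxColour-downFrom ((_ , c) ∷ D) {suc k} cols≡ =
  let c≡ , cols≡′ = ∷-injective cols≡
  in trans (cong₂ _⊔_ c≡ (maxColour-downFrom D cols≡′)) (m≥n⇒m⊔n≡m (n≤1+n k))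

-- ffRun puts the most recently coloured vertex first, hence the reverse.
colouring : ∀ {V : Set} → (V → ℕ) → List V → List (V × ℕ)
colouring c xs = reverse (map (λ x → x , c x) xs)

module _ {V : Set} {c : V → ℕ} where

  ∈-colouring⁻ : ∀ {xs w z} → (w , z) ∈ colouring c xs → w ∈ xs × c w ≡ z
  ∈-colouring⁻ wz∈ with ∈-map⁻ (λ x → x , c x) (reverse⁻ wz∈)
  ... | _ , w∈xs , refl = w∈xs , refl

  ∈-colouring⁺ : ∀ {xs w} → w ∈ xs → (w , c w) ∈ colouring c xs
  ∈-colouring⁺ w∈xs = reverse⁺ (∈-map⁺ (λ x → x , c x) w∈xs)

  colouring-∷ʳ : ∀ xs x → colouring c (xs ++ [ x ]) ≡ (x , c x) ∷ colouring c xs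
  colouring-∷ʳ xs x = begin
    reverse (map _ (xs ++ [ x ]))       ≡⟨ cong reverse (map-++ _ xs [ x ]) ⟩
    reverse (map _ xs ++ [ (x , c x) ]) ≡⟨ reverse-++ (map _ xs) [ (x , c x) ] ⟩
    (x , c x) ∷ colouring c xs          ∎
    where open ≡-Reasoning

maxColour-colouring-mono : ∀ {V W : Set} {c : V → ℕ} {d : W → ℕ} {xs ys} →
  (∀ {x} → x ∈ xs → ∃ λ y → y ∈ ys × d y ≡ c x) → maxColour (colouring c xs) ≤ maxColour (colouring d ys)
maxColour-colouring-mono {c = c} {xs = xs} covered with maxColour-attained (colouring c xs)
... | inj₁ max≡0        = subst (_≤ _) (sym max≡0) z≤n
... | inj₂ (x , xmax∈) =
  let x∈xs , cx≡max = ∈-colouring⁻ xmax∈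
      y , y∈ys , dy≡cx = covered x∈xs
  in subst (_≤ _) (trans dy≡cx cx≡max) (maxColour-≥ (∈-colouring⁺ y∈ys))

maxColour-colouring-cong : ∀ {V W : Set} {c : V → ℕ} {d : W → ℕ} {xs ys} →
  (∀ {x} → x ∈ xs → ∃ λ y → y ∈ ys × d y ≡ c x) → (∀ {y} → y ∈ ys → ∃ λ x → x ∈ xs × c x ≡ d y) →
  maxColour (colouring c xs) ≡ maxColour (colouring d ys)
maxColour-colouring-cong covered covered′ = ≤-antisym (maxColour-colouring-mono covered) (maxColour-colouring-mono covered′)

module FirstFit {V : Set} (adj : V → V → Bool) where

  NeighbourColour : List (V × ℕ) → V → ℕ → Set
  NeighbourColour D v z = ∃ λ w → (w , z) ∈ D × T (adj w v)

  usedOn⇒ : ∀ D v z → T (usedOn adj D v z) → NeighbourColour D v z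
  usedOn⇒ D v z used =
    let (w , c) , wc∈D , adj∧eq = find (any⁻ _ D used)
        w~v , c≡ᵇz = Equivalence.to T-∧ adj∧eq
    in w , subst (λ c → (w , c) ∈ D) (≡ᵇ⇒≡ c z c≡ᵇz) wc∈D , w~v

  usedOn⇐ : ∀ {D v z} → NeighbourColour D v z → T (usedOn adj D v z)
  usedOn⇐ {z = z} (w , wz∈D , w~v) = any⁺ _ (lose wz∈D (Equivalence.from T-∧ (w~v , ≡⇒≡ᵇ z z refl)))

  firstFree-search : ∀ D v c fuel → 1 ≤ c → (∀ {z} → 1 ≤ z → z < c → NeighbourColour D v z) →
                     LeastFree (NeighbourColour D v) (firstFree adj D v c fuel)
                     ⊎ (∀ {z} → 1 ≤ z → z < c + fuel → NeighbourColour D v z)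
  firstFree-search D v c zero 1≤c below = inj₂ (λ {z} 1≤z z< → below 1≤z (subst (z <_) (+-identityʳ c) z<))
  firstFree-search D v c (suc fuel) 1≤c below with usedOn adj D v c in used
  ... | false = inj₁ (record { positive = 1≤c ; free = λ c∈ → subst T used (usedOn⇐ c∈) ; saturated = below })
  ... | true  = Sum.map id (λ all {z} 1≤z z< → all 1≤z (subst (z <_) (+-suc c fuel) z<))
                  (firstFree-search D v (suc c) fuel (m≤n⇒m≤1+n 1≤c) below′)
    where
    below′ : ∀ {z} → 1 ≤ z → z < suc c → NeighbourColour D v z
    below′ 1≤z z<1+c with m<1+n⇒m<n∨m≡n z<1+c
    ... | inj₁ z<c  = below 1≤z z<c
    ... | inj₂ refl = usedOn⇒ D v c (subst T (sym used) tt)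

  ffColour : List (V × ℕ) → V → ℕ
  ffColour D v = firstFree adj D v 1 (suc (len D))

  -- The fuel suffices: D carries only len D colours, so they cannot fill 1 … len D + 1.
  ffColour-leastFree : ∀ D v → LeastFree (NeighbourColour D v) (ffColour D v)
  ffColour-leastFree D v with firstFree-search D v 1 (suc (len D)) ≤-refl (λ 1≤z z<1 → ⊥-elim (<⇒≱ z<1 1≤z))
  ... | inj₁ lf  = lf
  ... | inj₂ all = ⊥-elim (<-irrefl refl (begin-strict
        len D                  <⟨ injection⇒≤length suc suc-injective (map proj₂ D) suc∈ ⟩
        length (map proj₂ D)   ≡⟨ length-map proj₂ D ⟩
        length D               ≡⟨ len≡length D ⟨
        len D                  ∎))
    where
    open ≤-Reasoning
    suc∈ : ∀ {z} → z < suc (len D) → suc z ∈ map proj₂ D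
    suc∈ z< = let _ , wz∈D , _ = all (s≤s z≤n) (s≤s z<) in ∈-map⁺ proj₂ wz∈D

  EarlierColour : (V → ℕ) → List V → V → ℕ → Set
  EarlierColour c P x z = ∃ λ w → w ∈ P × T (adj w x) × c w ≡ z

  data IsFirstFit (c : V → ℕ) : List V → List V → Set where
    []  : ∀ {P} → IsFirstFit c P []
    _∷_ : ∀ {P x xs} → LeastFree (EarlierColour c P x) (c x) → IsFirstFit c (P ++ [ x ]) xs →
          IsFirstFit c P (x ∷ xs)

  module _ {c : V → ℕ} where

    neighbourColour⇒earlierColour : ∀ {P x z} → NeighbourColour (colouring c P) x z → EarlierColour c P x z
    neighbourColour⇒earlierColour (w , wz∈ , w~x) = let w∈P , cw≡z = ∈-colouring⁻ wz∈ in w , w∈P , w~x , cw≡z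

    earlierColour⇒neighbourColour : ∀ {P x z} → EarlierColour c P x z → NeighbourColour (colouring c P) x z
    earlierColour⇒neighbourColour (w , w∈P , w~x , refl) = w , ∈-colouring⁺ w∈P , w~x

    IsFirstFit-++ : ∀ {P xs ys} → IsFirstFit c P xs → IsFirstFit c (P ++ xs) ys → IsFirstFit c P (xs ++ ys)
    IsFirstFit-++ {P} []                       ff = subst (λ Q → IsFirstFit c Q _) (++-identityʳ P) ff
    IsFirstFit-++ {P} (_∷_ {x = x} {xs} lf ffxs) ff =
      lf ∷ IsFirstFit-++ ffxs (subst (λ Q → IsFirstFit c Q _) (sym (++-assoc P [ x ] xs)) ff)

    IsFirstFit-at : ∀ {Q} P {x S} → IsFirstFit c Q (P ++ x ∷ S) → LeastFree (EarlierColour c (Q ++ P) x) (c x)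
    IsFirstFit-at {Q} []      (lf ∷ _) = subst (λ R → LeastFree (EarlierColour c R _) _) (sym (++-identityʳ Q)) lf
    IsFirstFit-at {Q} (y ∷ P) (_ ∷ ff) =
      subst (λ R → LeastFree (EarlierColour c R _) _) (++-assoc Q [ y ] P) (IsFirstFit-at P ff)

    ffRun-firstFit : ∀ {P xs} → IsFirstFit c P xs → ffRun adj (colouring c P) xs ≡ colouring c (P ++ xs)
    ffRun-firstFit {P} [] = cong (colouring c) (sym (++-identityʳ P))
    ffRun-firstFit {P} (_∷_ {x = x} {xs} lf ff) = begin
      ffRun adj ((x , ffColour (colouring c P) x) ∷ colouring c P) xs ≡⟨ cong (λ k → ffRun adj ((x , k) ∷ colouring c P) xs) ffColour≡ ⟩
      ffRun adj ((x , c x) ∷ colouring c P) xs                       ≡⟨ cong (λ D → ffRun adj D xs) (colouring-∷ʳ P x) ⟨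
      ffRun adj (colouring c (P ++ [ x ])) xs                        ≡⟨ ffRun-firstFit ff ⟩
      colouring c ((P ++ [ x ]) ++ xs)                               ≡⟨ cong (colouring c) (++-assoc P [ x ] xs) ⟩
      colouring c (P ++ x ∷ xs)                                      ∎
      where
      open ≡-Reasoning
      ffColour≡ : ffColour (colouring c P) x ≡ c x
      ffColour≡ = LeastFree-unique (ffColour-leastFree _ _)
                    (LeastFree-resp earlierColour⇒neighbourColour neighbourColour⇒earlierColour lf)

  ffRun-mono : ∀ {D p} xs → p ∈ D → p ∈ ffRun adj D xs
  ffRun-mono []       p∈D = p∈D
  ffRun-mono (x ∷ xs) p∈D = ffRun-mono xs (there p∈D)

  ffRun-keys-unique : ∀ {D} xs → Unique (map proj₁ D) → Unique xs → (∀ {x} → x ∈ xs → x ∉ map proj₁ D) →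
                      Unique (map proj₁ (ffRun adj D xs))
  ffRun-keys-unique []       uD _             _     = uD
  ffRun-keys-unique (x ∷ xs) uD (x∉xs ∷ uxs) fresh =
    ffRun-keys-unique xs (¬Any⇒All¬ _ (fresh (here refl)) ∷ uD) uxs fresh′
    where
    fresh′ : ∀ {y} → y ∈ xs → y ∉ x ∷ map proj₁ _
    fresh′ y∈xs (here refl) = All.lookup x∉xs y∈xs refl
    fresh′ y∈xs (there y∈D) = fresh (there y∈xs) y∈D

  module _ (_≟ᵥ_ : DecidableEquality V) where

    colourIn : List (V × ℕ) → V → ℕ
    colourIn []            v = 0
    colourIn ((w , c) ∷ D) v with v ≟ᵥ w
    ... | yes _ = c
    ... | no  _ = colourIn D v

    colourIn-correct : ∀ {D w c} → Unique (map proj₁ D) → (w , c) ∈ D → colourIn D w ≡ c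
    colourIn-correct {(w , c) ∷ D} _ (here refl) with w ≟ᵥ w
    ... | yes _   = refl
    ... | no  w≢w = ⊥-elim (w≢w refl)
    colourIn-correct {(w′ , c′) ∷ D} {w} (w′∉ ∷ uD) (there wc∈D) with w ≟ᵥ w′
    ... | yes refl = ⊥-elim (All.lookup w′∉ (∈-map⁺ proj₁ wc∈D) refl)
    ... | no  _    = colourIn-correct uD wc∈D

    firstFit-exists : ∀ {xs} → Unique xs → ∃ λ c → IsFirstFit c [] xs
    firstFit-exists {xs} uxs = c , follow [] xs refl
      where
      R : List (V × ℕ)
      R = ffRun adj [] xs
      c : V → ℕ
      c = colourIn R
      follow : ∀ P ys → ffRun adj (colouring c P) ys ≡ R → IsFirstFit c P ys
      follow P []       _     = []
      follow P (y ∷ ys) run≡R =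
        subst (LeastFree _) (sym cy≡)
          (LeastFree-resp neighbourColour⇒earlierColour earlierColour⇒neighbourColour (ffColour-leastFree D y))
        ∷ follow (P ++ [ y ]) ys (trans (cong (λ D′ → ffRun adj D′ ys) colouring≡) run≡R)
        where
        D : List (V × ℕ)
        D = colouring c P
        cy≡ : c y ≡ ffColour D y
        cy≡ = colourIn-correct (ffRun-keys-unique xs [] uxs (λ _ ()))
                (subst (_ ∈_) run≡R (ffRun-mono ys (here refl)))
        colouring≡ : colouring c (P ++ [ y ]) ≡ (y , ffColour D y) ∷ D
        colouring≡ = trans (colouring-∷ʳ P y) (cong (λ k → (y , k) ∷ D) cy≡)

  module _ {c : V → ℕ} {ord : List V} (ff : IsFirstFit c [] ord) where

    firstFit-leastFree : ∀ {P x S} → ord ≡ P ++ x ∷ S → LeastFree (EarlierColour c P x) (c x)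
    firstFit-leastFree {P} refl = IsFirstFit-at P ff

    firstFit-positive : ∀ {x} → x ∈ ord → 1 ≤ c x
    firstFit-positive x∈ord = let _ , _ , split = ∈-∃++ x∈ord in LeastFree.positive (firstFit-leastFree split)

    FFgen-firstFit : FFgen adj ord ≡ maxColour (colouring c ord)
    FFgen-firstFit = cong maxColour (ffRun-firstFit ff)

    firstFit-≤-FF : ∀ {x} → x ∈ ord → c x ≤ FFgen adj ord
    firstFit-≤-FF x∈ord = subst (c _ ≤_) (sym FFgen-firstFit) (maxColour-≥ (∈-colouring⁺ x∈ord))

    -- The largest colour occurs, and below it every positive colour occurs on an earlier vertex.
    firstFit-onto : ∀ {z} → 1 ≤ z → z ≤ FFgen adj ord → ∃ λ x → x ∈ ord × c x ≡ z
    firstFit-onto {z} 1≤z z≤FF with maxColour-attained (colouring c ord)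
    ... | inj₁ max≡0 = ⊥-elim (<⇒≱ 1≤z (≤-trans z≤FF (≤-reflexive (trans FFgen-firstFit max≡0))))
    ... | inj₂ (x , xmax∈) with ∈-colouring⁻ xmax∈
    ...   | x∈ord , cx≡max with m≤n⇒m<n∨m≡n (subst (z ≤_) (trans FFgen-firstFit (sym cx≡max)) z≤FF)
    ...     | inj₂ z≡cx = x , x∈ord , sym z≡cx
    ...     | inj₁ z<cx =
      let P , S , split = ∈-∃++ x∈ord
          w , w∈P , _ , cw≡z = LeastFree.saturated (firstFit-leastFree split) 1≤z z<cx
      in w , ∈-split split (inj₁ w∈P) , cw≡z

  module _ (complete : ∀ {w x} → w ≢ x → T (adj w x)) where

    ffRun-complete : ∀ {k D} xs → Unique xs → (∀ {x} → x ∈ xs → x ∉ map proj₁ D) →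
                     map proj₂ D ≡ map suc (downFrom k) → map proj₂ (ffRun adj D xs) ≡ map suc (downFrom (length xs + k))
    ffRun-complete          []       _             _     cols≡ = cols≡
    ffRun-complete {k} {D} (x ∷ xs) (x∉xs ∷ uxs) fresh cols≡ = begin
      map proj₂ (ffRun adj ((x , ffColour D x) ∷ D) xs) ≡⟨ cong (λ c → map proj₂ (ffRun adj ((x , c) ∷ D) xs)) colour≡ ⟩
      map proj₂ (ffRun adj ((x , suc k) ∷ D) xs)        ≡⟨ ffRun-complete xs uxs fresh′ (cong (suc k ∷_) cols≡) ⟩
      map suc (downFrom (length xs + suc k))             ≡⟨ cong (map suc ∘ downFrom) (+-suc (length xs) k) ⟩
      map suc (downFrom (suc (length xs) + k))           ∎
      where
      open ≡-Reasoning
      saturated : ∀ {z} → 1 ≤ z → z < suc k → NeighbourColour D x z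
      saturated {suc z} _ (s≤s z<k)
        with (w , _) , wz∈D , refl ← ∈-map⁻ proj₂ (subst (suc z ∈_) (sym cols≡) (∈-map⁺ suc (∈-downFrom⁺ z<k)))
        = w , wz∈D , complete (λ { refl → fresh (here refl) (∈-map⁺ proj₁ wz∈D) })
      next : LeastFree (NeighbourColour D x) (suc k)
      next = record
        { positive  = s≤s z≤n
        ; free      = λ (_ , wk∈D , _) →
            let j , j∈ , k≡ = ∈-map⁻ suc (subst (suc k ∈_) cols≡ (∈-map⁺ proj₂ wk∈D))
            in <-irrefl (sym (suc-injective k≡)) (∈-downFrom⁻ j∈)
        ; saturated = saturated }
      colour≡ : ffColour D x ≡ suc k
      colour≡ = LeastFree-unique (ffColour-leastFree D x) next
      fresh′ : ∀ {y} → y ∈ xs → y ∉ x ∷ map proj₁ D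
      fresh′ y∈xs (here refl) = All.lookup x∉xs y∈xs refl
      fresh′ y∈xs (there y∈D) = fresh (there y∈xs) y∈D

-- The least positive integer missing from cs is the First-Fit colour of a vertex adjacent to
-- vertices coloured cs.
mex : List ℕ → ℕ
mex cs = ffColour (map (tt ,_) cs) tt
  where open FirstFit (λ _ _ → true)

mex-leastFree : ∀ cs → LeastFree (_∈ cs) (mex cs)
mex-leastFree cs = LeastFree-resp to from (ffColour-leastFree (map (tt ,_) cs) tt)
  where
  open FirstFit (λ _ _ → true)
  to : ∀ {z} → NeighbourColour (map (tt ,_) cs) tt z → z ∈ cs
  to (_ , tz∈ , _) with ∈-map⁻ (tt ,_) tz∈
  ... | _ , z∈cs , refl = z∈cs
  from : ∀ {z} → z ∈ cs → NeighbourColour (map (tt ,_) cs) tt z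
  from z∈cs = tt , ∈-map⁺ (tt ,_) z∈cs , tt

-- Each row of mexTable is computed from the list of the rows above it (nearest first), so that
-- mexTable-mex below holds.
mutual
  row : List (ℕ → ℕ) → ℕ → ℕ
  row rs y = mex (map (λ r → r y) rs ++ rowPrefix rs y)

  rowPrefix : List (ℕ → ℕ) → ℕ → List ℕ
  rowPrefix rs zero    = []
  rowPrefix rs (suc y) = row rs y ∷ rowPrefix rs y

rowsAbove : ℕ → List (ℕ → ℕ)
rowsAbove zero    = []
rowsAbove (suc x) = row (rowsAbove x) ∷ rowsAbove x

mexTable : ℕ → ℕ → ℕ
mexTable x = row (rowsAbove x)

rowsAbove≡ : ∀ x → rowsAbove x ≡ map mexTable (downFrom x)
rowsAbove≡ zero    = refl
rowsAbove≡ (suc x) = cong (mexTable x ∷_) (rowsAbove≡ x)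

rowPrefix≡ : ∀ rs y → rowPrefix rs y ≡ map (row rs) (downFrom y)
rowPrefix≡ rs zero    = refl
rowPrefix≡ rs (suc y) = cong (row rs y ∷_) (rowPrefix≡ rs y)

mexTable-mex : ∀ x y → mexTable x y ≡ mex (map (λ s → mexTable s y) (downFrom x) ++ map (mexTable x) (downFrom y))
mexTable-mex x y = cong₂ (λ column row → mex (column ++ row))
  (trans (cong (map (λ r → r y)) (rowsAbove≡ x)) (sym (map-∘ (downFrom x))))
  (rowPrefix≡ (rowsAbove x) y)

TableUsed : ℕ → ℕ → ℕ → Set
TableUsed x y z = (∃ λ s → s < x × mexTable s y ≡ z) ⊎ (∃ λ t → t < y × mexTable x t ≡ z)

mexTable-leastFree : ∀ x y → LeastFree (TableUsed x y) (mexTable x y)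
mexTable-leastFree x y =
  subst (LeastFree _) (sym (mexTable-mex x y)) (LeastFree-resp to from (mex-leastFree (column ++ row′)))
  where
  column row′ : List ℕ
  column = map (λ s → mexTable s y) (downFrom x)
  row′   = map (mexTable x) (downFrom y)
  to : ∀ {z} → z ∈ column ++ row′ → TableUsed x y z
  to z∈ with ∈-++⁻ column z∈
  ... | inj₁ z∈column = let s , s∈ , z≡ = ∈-map⁻ _ z∈column in inj₁ (s , ∈-downFrom⁻ s∈ , sym z≡)
  ... | inj₂ z∈row    = let t , t∈ , z≡ = ∈-map⁻ _ z∈row in inj₂ (t , ∈-downFrom⁻ t∈ , sym z≡)
  from : ∀ {z} → TableUsed x y z → z ∈ column ++ row′
  from (inj₁ (s , s<x , refl)) = ∈-++⁺ˡ (∈-map⁺ _ (∈-downFrom⁺ s<x))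
  from (inj₂ (t , t<y , refl)) = ∈-++⁺ʳ column (∈-map⁺ _ (∈-downFrom⁺ t<y))

-- Indexed by colours (from 1), so boxColour 0 y is junk.
boxColour : ℕ → ℕ → ℕ
boxColour x y = mexTable (pred x) (pred y)

BoxUsed : ℕ → ℕ → ℕ → Set
BoxUsed x y z = (∃ λ s → 1 ≤ s × s < x × boxColour s y ≡ z) ⊎ (∃ λ t → 1 ≤ t × t < y × boxColour x t ≡ z)

boxColour-leastFree : ∀ {x y} → 1 ≤ x → 1 ≤ y → LeastFree (BoxUsed x y) (boxColour x y)
boxColour-leastFree {suc x} {suc y} _ _ = LeastFree-resp to from (mexTable-leastFree x y)
  where
  to : ∀ {z} → TableUsed x y z → BoxUsed (suc x) (suc y) z
  to (inj₁ (s , s<x , eq)) = inj₁ (suc s , s≤s z≤n , s≤s s<x , eq)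
  to (inj₂ (t , t<y , eq)) = inj₂ (suc t , s≤s z≤n , s≤s t<y , eq)
  from : ∀ {z} → BoxUsed (suc x) (suc y) z → TableUsed x y z
  from (inj₁ (suc s , _ , s≤s s<x , eq)) = inj₁ (s , s<x , eq)
  from (inj₂ (suc t , _ , s≤s t<y , eq)) = inj₂ (t , t<y , eq)

boxColour-injectiveˡ : ∀ {s x y} → 1 ≤ s → 1 ≤ x → 1 ≤ y → boxColour s y ≡ boxColour x y → s ≡ x
boxColour-injectiveˡ {s} {x} 1≤s 1≤x 1≤y eq with <-cmp s x
... | tri< s<x _ _ = ⊥-elim (LeastFree.free (boxColour-leastFree 1≤x 1≤y) (inj₁ (s , 1≤s , s<x , eq)))
... | tri≈ _ s≡x _ = s≡x
... | tri> _ _ s>x = ⊥-elim (LeastFree.free (boxColour-leastFree 1≤s 1≤y) (inj₁ (x , 1≤x , s>x , sym eq)))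

boxColour-injectiveʳ : ∀ {t x y} → 1 ≤ t → 1 ≤ x → 1 ≤ y → boxColour x t ≡ boxColour x y → t ≡ y
boxColour-injectiveʳ {t} {x} {y} 1≤t 1≤x 1≤y eq with <-cmp t y
... | tri< t<y _ _ = ⊥-elim (LeastFree.free (boxColour-leastFree 1≤x 1≤y) (inj₂ (t , 1≤t , t<y , eq)))
... | tri≈ _ t≡y _ = t≡y
... | tri> _ _ t>y = ⊥-elim (LeastFree.free (boxColour-leastFree 1≤x 1≤t) (inj₂ (y , 1≤y , t>y , sym eq)))

BoxColours : ℕ → ℕ → ℕ → Set
BoxColours p q z = ∃₂ λ x y → (1 ≤ x × x ≤ p) × (1 ≤ y × y ≤ q) × boxColour x y ≡ z

allFin-unique : ∀ n → Unique (allFin n)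
allFin-unique zero    = []
allFin-unique (suc n) = ¬Any⇒All¬ _ zero∉ ∷ Unique.map⁺ Fin-suc-injective (allFin-unique n)
  where
  zero∉ : Fin.zero ∉ map Fin.suc (allFin n)
  zero∉ z∈ with ∈-map⁻ Fin.suc z∈
  ... | _ , _ , ()

length-allFin : ∀ n → length (allFin n) ≡ n
length-allFin zero    = refl
length-allFin (suc n) = cong suc (trans (length-map Fin.suc (allFin n)) (length-allFin n))

orderList-unique : ∀ {n} (σ : Ordering n) → Unique (orderList σ)
orderList-unique {n} σ = Unique.map⁺ from-injective (allFin-unique n)
  where
  from-injective : ∀ {i j} → Inverse.from σ i ≡ Inverse.from σ j → i ≡ j
  from-injective {i} {j} eq =
    trans (sym (Inverse.strictlyInverseˡ σ i)) (trans (cong (Inverse.to σ) eq) (Inverse.strictlyInverseˡ σ j))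

length-orderList : ∀ {n} (σ : Ordering n) → length (orderList σ) ≡ n
length-orderList {n} σ = trans (length-map _ (allFin n)) (length-allFin n)

concatMap≡cartesianProduct : ∀ {A B : Set} (xs : List A) (ys : List B) →
                           concatMap (λ u → map (u ,_) ys) xs ≡ cartesianProduct xs ys
concatMap≡cartesianProduct []       ys = refl
concatMap≡cartesianProduct (x ∷ xs) ys = cong (map (x ,_) ys ++_) (concatMap≡cartesianProduct xs ys)

module _ {m n} (G : Graph m) (H : Graph n) where

  boxAdj⁻ : ∀ {u u′ v v′} → T (boxAdj G H (u′ , v′) (u , v)) → (u′ ≡ u × T (adj H v′ v)) ⊎ (T (adj G u′ u) × v′ ≡ v)
  boxAdj⁻ uv′~uv = Sum.map (map₁ toWitness ∘ Equivalence.to T-∧) (map₂ toWitness ∘ Equivalence.to T-∧)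
                           (Equivalence.to T-∨ uv′~uv)

  boxAdj-row : ∀ {u v v′} → T (adj H v′ v) → T (boxAdj G H (u , v′) (u , v))
  boxAdj-row {u} {v} {v′} v′~v =
    Equivalence.from (T-∨ {eqᵇ u u ∧ adj H v′ v}) (inj₁ (Equivalence.from (T-∧ {eqᵇ u u}) (fromWitness refl , v′~v)))

  boxAdj-column : ∀ {u u′ v} → T (adj G u′ u) → T (boxAdj G H (u′ , v) (u , v))
  boxAdj-column {u} {u′} {v} u′~u =
    Equivalence.from (T-∨ {eqᵇ u′ u ∧ adj H v v}) (inj₂ (Equivalence.from (T-∧ {adj G u′ u}) (u′~u , fromWitness refl)))

module LexProduct {m n} (G : Graph m) (σ : Ordering m) (H : Graph n) (σ′ : Ordering n) where

  ordG : List (Fin m)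
  ordG = orderList σ

  ordH : List (Fin n)
  ordH = orderList σ′

  lex : List (Fin m × Fin n)
  lex = cartesianProduct ordG ordH

  module FG = FirstFit (adj G)
  module FH = FirstFit (adj H)
  open FirstFit (boxAdj G H)

  a : Fin m → ℕ
  a = proj₁ (FG.firstFit-exists _≟_ (orderList-unique σ))

  b : Fin n → ℕ
  b = proj₁ (FH.firstFit-exists _≟_ (orderList-unique σ′))

  ffG : FG.IsFirstFit a [] ordG
  ffG = proj₂ (FG.firstFit-exists _≟_ (orderList-unique σ))

  ffH : FH.IsFirstFit b [] ordH
  ffH = proj₂ (FH.firstFit-exists _≟_ (orderList-unique σ′))

  colour : Fin m × Fin n → ℕ
  colour (u , v) = boxColour (a u) (b v)

  Prefix : List (Fin m) → Fin m → List (Fin n) → List (Fin m × Fin n)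
  Prefix PG u PH = cartesianProduct PG ordH ++ map (u ,_) PH

  ∈-Prefix⁻ : ∀ {PG u PH u′ v′} → (u′ , v′) ∈ Prefix PG u PH → u′ ∈ PG ⊎ (u′ ≡ u × v′ ∈ PH)
  ∈-Prefix⁻ {PG} w∈ with ∈-++⁻ (cartesianProduct PG ordH) w∈
  ... | inj₁ w∈rows = inj₁ (proj₁ (∈-cartesianProduct⁻ PG ordH w∈rows))
  ... | inj₂ w∈row with ∈-map⁻ _ w∈row
  ...   | _ , v′∈PH , refl = inj₂ (refl , v′∈PH)

  leastFree-at : ∀ {PG u SG PH v SH} → ordG ≡ PG ++ u ∷ SG → ordH ≡ PH ++ v ∷ SH →
                 LeastFree (EarlierColour colour (Prefix PG u PH) (u , v)) (colour (u , v))
  leastFree-at {PG} {u} {SG} {PH} {v} {SH} splitG splitH = record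
    { positive  = LeastFree.positive (boxColour-leastFree 1≤au 1≤bv)
    ; free      = free
    ; saturated = saturated }
    where
    lfG : LeastFree (FG.EarlierColour a PG u) (a u)
    lfG = FG.firstFit-leastFree ffG splitG
    lfH : LeastFree (FH.EarlierColour b PH v) (b v)
    lfH = FH.firstFit-leastFree ffH splitH
    1≤au : 1 ≤ a u
    1≤au = LeastFree.positive lfG
    1≤bv : 1 ≤ b v
    1≤bv = LeastFree.positive lfH
    free : ¬ EarlierColour colour (Prefix PG u PH) (u , v) (colour (u , v))
    free ((u′ , v′) , w∈ , w~uv , same) with boxAdj⁻ G H w~uv | ∈-Prefix⁻ w∈
    ... | inj₁ (refl , v′~v) | inj₁ u∈PG        = Unique-∉-prefix PG (subst Unique splitG (orderList-unique σ)) u∈PG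
    ... | inj₁ (refl , v′~v) | inj₂ (_ , v′∈PH) =
      LeastFree.free lfH (v′ , v′∈PH , v′~v ,
        boxColour-injectiveʳ (FH.firstFit-positive ffH (∈-split splitH (inj₁ v′∈PH))) 1≤au 1≤bv same)
    ... | inj₂ (u′~u , refl) | inj₁ u′∈PG       =
      LeastFree.free lfG (u′ , u′∈PG , u′~u ,
        boxColour-injectiveˡ (FG.firstFit-positive ffG (∈-split splitG (inj₁ u′∈PG))) 1≤au 1≤bv same)
    ... | inj₂ (u′~u , refl) | inj₂ (_ , v∈PH)  = Unique-∉-prefix PH (subst Unique splitH (orderList-unique σ′)) v∈PH
    saturated : ∀ {z} → 1 ≤ z → z < colour (u , v) → EarlierColour colour (Prefix PG u PH) (u , v) z
    saturated 1≤z z< with LeastFree.saturated (boxColour-leastFree 1≤au 1≤bv) 1≤z z<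
    ... | inj₁ (s , 1≤s , s<au , colour≡z) =
      let u′ , u′∈PG , u′~u , au′≡s = LeastFree.saturated lfG 1≤s s<au
      in (u′ , v) , ∈-++⁺ˡ (∈-cartesianProduct⁺ u′∈PG (∈-split splitH (inj₂ refl))) , boxAdj-column G H u′~u ,
         trans (cong (λ x → boxColour x (b v)) au′≡s) colour≡z
    ... | inj₂ (t , 1≤t , t<bv , colour≡z) =
      let v′ , v′∈PH , v′~v , bv′≡t = LeastFree.saturated lfH 1≤t t<bv
      in (u , v′) , ∈-++⁺ʳ (cartesianProduct PG ordH) (∈-map⁺ (u ,_) v′∈PH) , boxAdj-row G H v′~v ,
         trans (cong (boxColour (a u)) bv′≡t) colour≡z

  row-firstFit : ∀ {PG u SG} → ordG ≡ PG ++ u ∷ SG → ∀ PH vs → ordH ≡ PH ++ vs →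
                 IsFirstFit colour (Prefix PG u PH) (map (u ,_) vs)
  row-firstFit splitG PH []       _      = []
  row-firstFit {PG} {u} splitG PH (v ∷ vs) splitH =
    leastFree-at splitG splitH
    ∷ subst (λ Q → IsFirstFit colour Q (map (u ,_) vs)) prefix≡
        (row-firstFit splitG (PH ++ [ v ]) vs (trans splitH (sym (++-assoc PH [ v ] vs))))
    where
    prefix≡ : Prefix PG u (PH ++ [ v ]) ≡ Prefix PG u PH ++ [ (u , v) ]
    prefix≡ = trans (cong (cartesianProduct PG ordH ++_) (map-++ (u ,_) PH [ v ]))
                    (sym (++-assoc (cartesianProduct PG ordH) (map (u ,_) PH) [ (u , v) ]))

  rows-firstFit : ∀ PG us → ordG ≡ PG ++ us → IsFirstFit colour (cartesianProduct PG ordH) (cartesianProduct us ordH)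
  rows-firstFit PG []       _      = []
  rows-firstFit PG (u ∷ us) splitG =
    IsFirstFit-++ (subst (λ Q → IsFirstFit colour Q (map (u ,_) ordH)) (++-identityʳ _) (row-firstFit splitG [] ordH refl))
                  (subst (λ Q → IsFirstFit colour Q (cartesianProduct us ordH)) rows≡
                     (rows-firstFit (PG ++ [ u ]) us (trans splitG (sym (++-assoc PG [ u ] us)))))
    where
    rows≡ : cartesianProduct (PG ++ [ u ]) ordH ≡ cartesianProduct PG ordH ++ map (u ,_) ordH
    rows≡ = trans (cartesianProductWith-distribʳ-++ _,_ PG [ u ] ordH)
                  (cong (cartesianProduct PG ordH ++_) (++-identityʳ (map (u ,_) ordH)))

  FFbox-colouring : FFbox G σ H σ′ ≡ maxColour (colouring colour lex)
  FFbox-colouring = trans (cong (FFgen (boxAdj G H)) (concatMap≡cartesianProduct ordG ordH))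
                          (FFgen-firstFit (rows-firstFit [] ordG refl))

  colour-range : ∀ {w} → w ∈ lex → BoxColours (FF G σ) (FF H σ′) (colour w)
  colour-range {u , v} w∈ =
    let u∈ , v∈ = ∈-cartesianProduct⁻ ordG ordH w∈
    in a u , b v , (FG.firstFit-positive ffG u∈ , FG.firstFit-≤-FF ffG u∈)
                 , (FH.firstFit-positive ffH v∈ , FH.firstFit-≤-FF ffH v∈) , refl

  colour-onto : ∀ {z} → BoxColours (FF G σ) (FF H σ′) z → ∃ λ w → w ∈ lex × colour w ≡ z
  colour-onto (x , y , (1≤x , x≤p) , (1≤y , y≤q) , refl) =
    let u , u∈ , au≡x = FG.firstFit-onto ffG 1≤x x≤p
        v , v∈ , bv≡y = FH.firstFit-onto ffH 1≤y y≤q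
    in (u , v) , ∈-cartesianProduct⁺ u∈ v∈ , cong₂ boxColour au≡x bv≡y

FF-complete : ∀ p → FF (K p) (idOrd p) ≡ p
FF-complete p = maxColour-downFrom _ (trans
  (ffRun-complete K-complete (orderList (idOrd p)) (orderList-unique (idOrd p)) (λ _ ()) refl)
  (cong (map suc ∘ downFrom) (trans (+-identityʳ _) (length-orderList (idOrd p)))))
  where
  open FirstFit (adj (K p))
  K-complete : ∀ {u v} → u ≢ v → T (adj (K p) u v)
  K-complete {u} {v} u≢v with u ≟ v
  ... | yes u≡v = u≢v u≡v
  ... | no  _   = tt

FFbox-determined : ∀ {m n m′ n′} (G : Graph m) (σ : Ordering m) (H : Graph n) (σ′ : Ordering n)
                   (G′ : Graph m′) (τ : Ordering m′) (H′ : Graph n′) (τ′ : Ordering n′) →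
                   FF G σ ≡ FF G′ τ → FF H σ′ ≡ FF H′ τ′ → FFbox G σ H σ′ ≡ FFbox G′ τ H′ τ′
FFbox-determined G σ H σ′ G′ τ H′ τ′ p≡ q≡ = begin
  FFbox G σ H σ′                         ≡⟨ L.FFbox-colouring ⟩
  maxColour (colouring L.colour L.lex)   ≡⟨ maxColour-colouring-cong covered covered′ ⟩
  maxColour (colouring L′.colour L′.lex) ≡⟨ L′.FFbox-colouring ⟨
  FFbox G′ τ H′ τ′                       ∎
  where
  open ≡-Reasoning
  module L  = LexProduct G σ H σ′
  module L′ = LexProduct G′ τ H′ τ′
  covered : ∀ {w} → w ∈ L.lex → ∃ λ w′ → w′ ∈ L′.lex × L′.colour w′ ≡ L.colour w
  covered w∈ = L′.colour-onto (subst₂ (λ p q → BoxColours p q _) p≡ q≡ (L.colour-range w∈))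
  covered′ : ∀ {w′} → w′ ∈ L′.lex → ∃ λ w → w ∈ L.lex × L.colour w ≡ L′.colour w′
  covered′ w′∈ = L.colour-onto (subst₂ (λ p q → BoxColours p q _) (sym p≡) (sym q≡) (L′.colour-range w′∈))

theorem3 : ∀ {m n : ℕ} (G : Graph m) (σ : Ordering m) (H : Graph n) (σ' : Ordering n)
    (p q : ℕ) → FF G σ ≡ p → FF H σ' ≡ q →
    FFbox G σ H σ' ≡ FFbox (K p) (idOrd p) (K q) (idOrd q)
theorem3 G σ H σ' p q FF≡p FF≡q =
  FFbox-determined G σ H σ' (K p) (idOrd p) (K q) (idOrd q)
    (trans FF≡p (sym (FF-complete p))) (trans FF≡q (sym (FF-complete q)))
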